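{- Let $p\in\mathfrak{S}_k$ and let $R\subseteq S\subseteq R'$ be subsets of $\{0,\dots,k\}^2$. If $(p,R)\asymp(p,R')$, then $(p,R)\asymp(p,S)\asymp(p,R')$.
   Context: A mesh pattern is a pair $(p,R)$ where $p\in\mathfrak{S}_k$ and $R\subseteq\{0,\dots,k\}^2$, where $(a,b)\in R$ denotes the unit square $[a,a+1]\times[b,b+1]$ in $[0,k+1]^2$. A permutation $w\in\mathfrak{S}_n$ contains $(p,R)$ if there are indices $1\le i_1<\dots<i_k\le n$ with $w(i_1)\cdots w(i_k)$ order isomorphic to $p$ such that, setting $i_0=0$, $i_{k+1}=n+1$, $v_0=0$, $v_{k+1}=n+1$ and $v_b=w(i_{p^{ -1}(b)})$ for $b\in[1,k]$, for every $(a,b)\in R$ the open rectangle $(i_a,i_{a+1})\times(v_b,v_{b+1})$ contains no point $(x,w(x))$. Otherwise $w$ avoids $(p,R)$. Mesh patterns $\pi,\sigma$ are coincident, $\pi\asymp\sigma$, if they are avoided by exactly the same permutations (of all sizes). -}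

module Defs where

open import Data.Nat using (ℕ; zero; suc; _<_; _<?_)
open import Data.Fin as Fin using (Fin; toℕ; fromℕ<)
open import Data.Fin.Permutation using (Permutation′; _⟨$⟩ʳ_; _⟨$⟩ˡ_)
open import Data.Bool using (Bool; true)
open import Data.Product using (Σ; _×_; ∃)
open import Relation.Nullary using (¬_; yes; no)
open import Relation.Binary.PropositionalEquality using (_≡_)
open import Function.Bundles using (_⇔_)

-- A shaded region R ⊆ {0,…,k}², given by its (decidable) characteristic function:
-- (a , b) ∈ R  iff  R a b ≡ true.
Region : ℕ → Set
Region k = Fin (suc k) → Fin (suc k) → Bool

_⊆ᴿ_ : ∀ {k} → Region k → Region k → Set
R ⊆ᴿ S = ∀ a b → R a b ≡ true → S a b ≡ true

record MeshPattern : Set where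
  constructor mesh
  field
    size  : ℕ
    perm  : Permutation′ size
    shade : Region size

bnd : ∀ {k} → (Fin k → ℕ) → ℕ → ℕ → ℕ
bnd f top zero = 0
bnd {k} f top (suc c) with c <? k
... | yes c<k = f (fromℕ< c<k)
... | no  _   = top

-- Permutations of size n act on Fin n (0-based); coordinates below are 1-based,
-- i.e. position x : Fin n is the point (toℕ x + 1 , toℕ (w x) + 1).
-- An occurrence of (p , R) in w given by the index embedding ι (ι j = i_{j+1} - 1).
Occurrence : ∀ {n} → Permutation′ n → (π : MeshPattern) → (Fin (MeshPattern.size π) → Fin n) → Set
Occurrence {n} w π ι =
    (∀ x y → x Fin.< y → ι x Fin.< ι y)
  × (∀ x y → (w ⟨$⟩ʳ ι x Fin.< w ⟨$⟩ʳ ι y) ⇔ (p ⟨$⟩ʳ x Fin.< p ⟨$⟩ʳ y))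
  × (∀ a b → R a b ≡ true → ∀ (x : Fin n) →
       ¬ ( (I (toℕ a) < suc (toℕ x)) × (suc (toℕ x) < I (suc (toℕ a)))
         × (V (toℕ b) < suc (toℕ (w ⟨$⟩ʳ x))) × (suc (toℕ (w ⟨$⟩ʳ x)) < V (suc (toℕ b)))))
  where
    open MeshPattern π renaming (size to k; perm to p; shade to R)
    -- i_0 = 0, i_j = ι (j-1) + 1, i_{k+1} = n + 1
    I : ℕ → ℕ
    I = bnd (λ j → suc (toℕ (ι j))) (suc n)
    -- v_0 = 0, v_b = w(i_{p⁻¹(b)}), v_{k+1} = n + 1
    V : ℕ → ℕ
    V = bnd (λ b → suc (toℕ (w ⟨$⟩ʳ ι (p ⟨$⟩ˡ b)))) (suc n)

Contains : ∀ {n} → Permutation′ n → MeshPattern → Set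
Contains {n} w π = ∃ λ (ι : Fin (MeshPattern.size π) → Fin n) → Occurrence w π ι

Avoids : ∀ {n} → Permutation′ n → MeshPattern → Set
Avoids w π = ¬ Contains w π

_≍_ : MeshPattern → MeshPattern → Set
π ≍ σ = ∀ n (w : Permutation′ n) → Avoids w π ⇔ Avoids w σ

module Submission where

-- Shading more cells makes a mesh pattern harder to contain: every occurrence of
-- (p , S) is, with the same index embedding, an occurrence of (p , R) whenever
-- R ⊆ S, since the emptiness conditions for R are among those for S.  Hence every
-- permutation avoiding (p , R) also avoids (p , S), i.e. the sets of avoiders
-- grow with the shading.
--
-- The theorem is then a sandwich argument in this preorder on mesh patterns:
-- for R ⊆ S ⊆ R′ the avoiders satisfy Av(p,R) ⊆ Av(p,S) ⊆ Av(p,R′), and if the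
-- outer two coincide, all three coincide.

open import Defs
open import Data.Nat using (ℕ)
open import Data.Fin using (Fin)
open import Data.Fin.Permutation using (Permutation′)
open import Data.Product using (_×_; _,_)
open import Function.Bundles using (mk⇔; Equivalence)

_≼_ : MeshPattern → MeshPattern → Set
π ≼ σ = ∀ n (w : Permutation′ n) → Avoids w π → Avoids w σ

occurrence-unshade : ∀ {k n} (p : Permutation′ k) {R S : Region k} → R ⊆ᴿ S →
  (w : Permutation′ n) (ι : Fin k → Fin n) →
  Occurrence w (mesh k p S) ι → Occurrence w (mesh k p R) ι
occurrence-unshade p R⊆S w ι (increasing , isomorphic , empty) =
  increasing , isomorphic , λ a b a,b∈R → empty a b (R⊆S a b a,b∈R)

shading-≼ : ∀ {k} (p : Permutation′ k) {R S : Region k} → R ⊆ᴿ S →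
  mesh k p R ≼ mesh k p S
shading-≼ p R⊆S n w avoidsR (ι , occS) =
  avoidsR (ι , occurrence-unshade p R⊆S w ι occS)

sandwich : ∀ {π σ τ} → π ≼ σ → σ ≼ τ → π ≍ τ → (π ≍ σ) × (σ ≍ τ)
sandwich {π} {σ} {τ} π≼σ σ≼τ π≍τ =
  (λ n w → mk⇔ (π≼σ n w) (λ avσ → τ⇒π n w (σ≼τ n w avσ))) ,
  (λ n w → mk⇔ (σ≼τ n w) (λ avτ → π≼σ n w (τ⇒π n w avτ)))
  where
    τ⇒π : ∀ n (w : Permutation′ n) → Avoids w τ → Avoids w π
    τ⇒π n w = Equivalence.from (π≍τ n w)

lemma7p3 : (k : ℕ) (p : Permutation′ k) (R S R′ : Region k) →
    R ⊆ᴿ S → S ⊆ᴿ R′ →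
    mesh k p R ≍ mesh k p R′ →
    (mesh k p R ≍ mesh k p S) × (mesh k p S ≍ mesh k p R′)
lemma7p3 k p R S R′ R⊆S S⊆R′ =
  sandwich {mesh k p R} {mesh k p S} {mesh k p R′} (shading-≼ p R⊆S) (shading-≼ p S⊆R′)
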